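{- For every $n\in\mathbb{N}$ let $$N_n(x)=\frac{1}{4n+2}\sum_{k=1}^{n-1}k(n-k)\binom{2n+2}{2k+1}x^k .$$ Then there are non-negative integers $\gamma_{n,k}$ such that $$N_n(x)=\sum_{k=0}^{\lfloor n/2\rfloor}\gamma_{n,k}\,x^k(1+x)^{n-2k}.$$ -}

module Defs where

open import Data.Nat using (ℕ; zero; suc; _+_; _*_; _∸_)
open import Data.List using (List; []; _∷_; map; foldr; upTo)
open import Relation.Binary.PropositionalEquality using (_≡_)

-- Univariate polynomials with natural-number coefficients,
-- represented by coefficient lists (lowest degree first).
Poly : Set
Poly = List ℕ

coeff : Poly → ℕ → ℕ
coeff []       _       = 0
coeff (a ∷ p)  zero    = a
coeff (a ∷ p)  (suc j) = coeff p j

-- polynomial equality (coefficientwise; insensitive to trailing zeros)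
_≈ₚ_ : Poly → Poly → Set
p ≈ₚ q = ∀ j → coeff p j ≡ coeff q j

infixl 6 _+ₚ_
infixl 7 _*ₚ_ _·ₚ_

_+ₚ_ : Poly → Poly → Poly
[]      +ₚ q       = q
(a ∷ p) +ₚ []      = a ∷ p
(a ∷ p) +ₚ (b ∷ q) = (a + b) ∷ (p +ₚ q)

_·ₚ_ : ℕ → Poly → Poly
c ·ₚ p = map (c *_) p

_*ₚ_ : Poly → Poly → Poly
[]      *ₚ q = []
(a ∷ p) *ₚ q = (a ·ₚ q) +ₚ (0 ∷ (p *ₚ q))

1ₚ : Poly
1ₚ = 1 ∷ []

X : Poly
X = 0 ∷ 1 ∷ []

_^ₚ_ : Poly → ℕ → Poly
p ^ₚ zero  = 1ₚ
p ^ₚ suc n = p *ₚ (p ^ₚ n)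

sumₚ : List ℕ → (ℕ → Poly) → Poly
sumₚ ks f = foldr (λ k acc → f k +ₚ acc) [] ks

range1 : ℕ → List ℕ
range1 m = map suc (upTo (m ∸ 1))

{-# OPTIONS --safe #-}
-- Write u = 1 + x.  Since (1 + √x)^(2n) = (u + 2√x)^n, splitting the binomial expansion of the
-- right-hand side by the parity of the power of √x gives polynomials
--   E_n = Σ_k 4^k C(n,2k) x^k u^(n−2k)   and   O_n = Σ_k 4^k C(n,2k+1) x^k u^(n−2k−1)
-- with [x^j] E_n = C(2n,2j) and 2 [x^j] O_n = C(2n,2j+1).  Formally this is an induction on n
-- through E_(n+1) = u E_n + 4x O_n and O_(n+1) = E_n + u O_n.  For γ_(n,k) = 2k 4^(k−1) C(n+1,2k+1)
-- the absorption identity gives 4 Σ_k γ_(n,k) x^k u^(n−2k) + O_(n+1) = (n+1) E_n term by term, so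
-- the coefficients of the γ-expansion are determined by C(2n,2j) and C(2n+2,2j+1); the ratio of
-- these two binomial coefficients turns this into (4n+2) [x^j] N_n = j (n−j) C(2n+2,2j+1).
module Submission where

open import Defs
open import Data.Nat using (ℕ; zero; suc; _+_; _*_; _∸_; _/_; _%_; _^_; _≤_; _<_; z≤n; s≤s; _≤?_)
open import Data.Nat.Properties
open import Algebra.Properties.CommutativeSemigroup +-commutativeSemigroup
  using () renaming (interchange to +-interchange)
open import Data.Nat.DivMod using (m≡m%n+[m/n]*n; m%n<n; m/n≤m)
open import Data.Nat.Tactic.RingSolver using (solve-∀)
open import Data.List using (List; []; _∷_; map; upTo)
open import Data.List.Properties using (map-upTo)
open import Data.Product using (∃; _,_)
open import Data.Nat.Combinatorics using (_C_; nCk+nC[k+1]≡[n+1]C[k+1]; k>n⇒nCk≡0; nC1≡n)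
open import Function using (_∘_)
open import Relation.Nullary using (yes; no)
open import Relation.Binary.Bundles using (Setoid)
open import Relation.Binary.PropositionalEquality
import Relation.Binary.Reasoning.Setoid as SetoidReasoning

-- A record wrapper around _≈ₚ_, so that both polynomials can be inferred.
infix 4 _≋_
record _≋_ (p q : Poly) : Set where
  constructor coeffwise
  field coeff-≡ : p ≈ₚ q
open _≋_

≋-refl : ∀ {p} → p ≋ p
≋-refl = coeffwise λ _ → refl

≋-sym : ∀ {p q} → p ≋ q → q ≋ p
≋-sym (coeffwise e) = coeffwise λ j → sym (e j)

≋-trans : ∀ {p q r} → p ≋ q → q ≋ r → p ≋ r
≋-trans (coeffwise e) (coeffwise f) = coeffwise λ j → trans (e j) (f j)

≡⇒≋ : ∀ {p q} → p ≡ q → p ≋ q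
≡⇒≋ refl = ≋-refl

≋-setoid : Setoid _ _
≋-setoid = record
  { Carrier       = Poly
  ; _≈_           = _≋_
  ; isEquivalence = record { refl = ≋-refl ; sym = ≋-sym ; trans = ≋-trans }
  }

module ≋-Reasoning = SetoidReasoning ≋-setoid

coeff-+ₚ : ∀ p q j → coeff (p +ₚ q) j ≡ coeff p j + coeff q j
coeff-+ₚ []      q       j       = refl
coeff-+ₚ (a ∷ p) []      j       = sym (+-identityʳ _)
coeff-+ₚ (a ∷ p) (b ∷ q) zero    = refl
coeff-+ₚ (a ∷ p) (b ∷ q) (suc j) = coeff-+ₚ p q j

coeff-·ₚ : ∀ c p j → coeff (c ·ₚ p) j ≡ c * coeff p j
coeff-·ₚ c []      j       = sym (*-zeroʳ c)
coeff-·ₚ c (a ∷ p) zero    = refl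
coeff-·ₚ c (a ∷ p) (suc j) = coeff-·ₚ c p j

coeff-∷-*ₚ-zero : ∀ a p q → coeff ((a ∷ p) *ₚ q) 0 ≡ a * coeff q 0
coeff-∷-*ₚ-zero a p q = begin
  coeff (a ·ₚ q +ₚ (0 ∷ p *ₚ q)) 0  ≡⟨ coeff-+ₚ (a ·ₚ q) (0 ∷ p *ₚ q) 0 ⟩
  coeff (a ·ₚ q) 0 + 0              ≡⟨ +-identityʳ _ ⟩
  coeff (a ·ₚ q) 0                  ≡⟨ coeff-·ₚ a q 0 ⟩
  a * coeff q 0                     ∎
  where open ≡-Reasoning

coeff-∷-*ₚ-suc : ∀ a p q j → coeff ((a ∷ p) *ₚ q) (suc j) ≡ a * coeff q (suc j) + coeff (p *ₚ q) j
coeff-∷-*ₚ-suc a p q j = trans (coeff-+ₚ (a ·ₚ q) (0 ∷ p *ₚ q) (suc j)) (cong (_+ _) (coeff-·ₚ a q (suc j)))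

+ₚ-cong : ∀ {p p′ q q′} → p ≋ p′ → q ≋ q′ → p +ₚ q ≋ p′ +ₚ q′
+ₚ-cong {p} {p′} {q} {q′} p≋p′ q≋q′ = coeffwise λ j → begin
  coeff (p +ₚ q) j         ≡⟨ coeff-+ₚ p q j ⟩
  coeff p j + coeff q j    ≡⟨ cong₂ _+_ (coeff-≡ p≋p′ j) (coeff-≡ q≋q′ j) ⟩
  coeff p′ j + coeff q′ j  ≡⟨ coeff-+ₚ p′ q′ j ⟨
  coeff (p′ +ₚ q′) j       ∎
  where open ≡-Reasoning

+ₚ-assoc : ∀ p q r → (p +ₚ q) +ₚ r ≋ p +ₚ (q +ₚ r)
+ₚ-assoc p q r = coeffwise λ j → begin
  coeff ((p +ₚ q) +ₚ r) j                ≡⟨ coeff-+ₚ (p +ₚ q) r j ⟩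
  coeff (p +ₚ q) j + coeff r j           ≡⟨ cong (_+ coeff r j) (coeff-+ₚ p q j) ⟩
  coeff p j + coeff q j + coeff r j      ≡⟨ +-assoc (coeff p j) _ _ ⟩
  coeff p j + (coeff q j + coeff r j)    ≡⟨ cong (coeff p j +_) (coeff-+ₚ q r j) ⟨
  coeff p j + coeff (q +ₚ r) j           ≡⟨ coeff-+ₚ p (q +ₚ r) j ⟨
  coeff (p +ₚ (q +ₚ r)) j                ∎
  where open ≡-Reasoning

+ₚ-comm : ∀ p q → p +ₚ q ≋ q +ₚ p
+ₚ-comm p q = coeffwise λ j →
  trans (coeff-+ₚ p q j) (trans (+-comm (coeff p j) (coeff q j)) (sym (coeff-+ₚ q p j)))

+ₚ-interchange : ∀ p q r s → (p +ₚ q) +ₚ (r +ₚ s) ≋ (p +ₚ r) +ₚ (q +ₚ s)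
+ₚ-interchange p q r s = coeffwise λ j → begin
  coeff ((p +ₚ q) +ₚ (r +ₚ s)) j                           ≡⟨ expand p q r s j ⟩
  (coeff p j + coeff q j) + (coeff r j + coeff s j)       ≡⟨ +-interchange (coeff p j) (coeff q j) _ _ ⟩
  (coeff p j + coeff r j) + (coeff q j + coeff s j)       ≡⟨ expand p r q s j ⟨
  coeff ((p +ₚ r) +ₚ (q +ₚ s)) j                           ∎
  where
  open ≡-Reasoning
  expand : ∀ p q r s j → coeff ((p +ₚ q) +ₚ (r +ₚ s)) j ≡ (coeff p j + coeff q j) + (coeff r j + coeff s j)
  expand p q r s j = trans (coeff-+ₚ (p +ₚ q) (r +ₚ s) j) (cong₂ _+_ (coeff-+ₚ p q j) (coeff-+ₚ r s j))

∷-cong : ∀ {a b p q} → a ≡ b → p ≋ q → a ∷ p ≋ b ∷ q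
∷-cong a≡b p≋q = coeffwise λ { zero → a≡b ; (suc j) → coeff-≡ p≋q j }

·ₚ-cong : ∀ c {p q} → p ≋ q → c ·ₚ p ≋ c ·ₚ q
·ₚ-cong c {p} {q} p≋q = coeffwise λ j →
  trans (coeff-·ₚ c p j) (trans (cong (c *_) (coeff-≡ p≋q j)) (sym (coeff-·ₚ c q j)))

≡0⇒·ₚ≋[] : ∀ {c} p → c ≡ 0 → c ·ₚ p ≋ []
≡0⇒·ₚ≋[] p refl = coeffwise (coeff-·ₚ 0 p)

·ₚ-assoc : ∀ c d p → (c * d) ·ₚ p ≋ c ·ₚ (d ·ₚ p)
·ₚ-assoc c d p = coeffwise λ j → begin
  coeff ((c * d) ·ₚ p) j    ≡⟨ coeff-·ₚ (c * d) p j ⟩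
  c * d * coeff p j         ≡⟨ *-assoc c d _ ⟩
  c * (d * coeff p j)       ≡⟨ cong (c *_) (coeff-·ₚ d p j) ⟨
  c * coeff (d ·ₚ p) j      ≡⟨ coeff-·ₚ c (d ·ₚ p) j ⟨
  coeff (c ·ₚ (d ·ₚ p)) j   ∎
  where open ≡-Reasoning

·ₚ-distribˡ : ∀ c p q → c ·ₚ (p +ₚ q) ≋ c ·ₚ p +ₚ c ·ₚ q
·ₚ-distribˡ c p q = coeffwise λ j → begin
  coeff (c ·ₚ (p +ₚ q)) j                      ≡⟨ coeff-·ₚ c (p +ₚ q) j ⟩
  c * coeff (p +ₚ q) j                         ≡⟨ cong (c *_) (coeff-+ₚ p q j) ⟩
  c * (coeff p j + coeff q j)                  ≡⟨ *-distribˡ-+ c _ _ ⟩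
  c * coeff p j + c * coeff q j                ≡⟨ cong₂ _+_ (coeff-·ₚ c p j) (coeff-·ₚ c q j) ⟨
  coeff (c ·ₚ p) j + coeff (c ·ₚ q) j          ≡⟨ coeff-+ₚ (c ·ₚ p) (c ·ₚ q) j ⟨
  coeff (c ·ₚ p +ₚ c ·ₚ q) j                   ∎
  where open ≡-Reasoning

·ₚ-distribʳ : ∀ c d p → (c + d) ·ₚ p ≋ c ·ₚ p +ₚ d ·ₚ p
·ₚ-distribʳ c d p = coeffwise λ j → begin
  coeff ((c + d) ·ₚ p) j                       ≡⟨ coeff-·ₚ (c + d) p j ⟩
  (c + d) * coeff p j                          ≡⟨ *-distribʳ-+ (coeff p j) c d ⟩
  c * coeff p j + d * coeff p j                ≡⟨ cong₂ _+_ (coeff-·ₚ c p j) (coeff-·ₚ d p j) ⟨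
  coeff (c ·ₚ p) j + coeff (d ·ₚ p) j          ≡⟨ coeff-+ₚ (c ·ₚ p) (d ·ₚ p) j ⟨
  coeff (c ·ₚ p +ₚ d ·ₚ p) j                   ∎
  where open ≡-Reasoning

·ₚ-identityˡ : ∀ p → 1 ·ₚ p ≋ p
·ₚ-identityˡ p = coeffwise λ j → trans (coeff-·ₚ 1 p j) (*-identityˡ _)

·ₚ-comm : ∀ c d p → c ·ₚ (d ·ₚ p) ≋ d ·ₚ (c ·ₚ p)
·ₚ-comm c d p = begin
  c ·ₚ (d ·ₚ p)  ≈⟨ ·ₚ-assoc c d p ⟨
  (c * d) ·ₚ p   ≡⟨ cong (_·ₚ p) (*-comm c d) ⟩
  (d * c) ·ₚ p   ≈⟨ ·ₚ-assoc d c p ⟩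
  d ·ₚ (c ·ₚ p)  ∎
  where open ≋-Reasoning

·ₚ-shift : ∀ c p → c ·ₚ (0 ∷ p) ≋ 0 ∷ c ·ₚ p
·ₚ-shift c p = ∷-cong (*-zeroʳ c) ≋-refl

*ₚ-congʳ : ∀ p {q q′} → q ≋ q′ → p *ₚ q ≋ p *ₚ q′
*ₚ-congʳ []      q≋q′ = ≋-refl
*ₚ-congʳ (a ∷ p) q≋q′ = +ₚ-cong (·ₚ-cong a q≋q′) (∷-cong refl (*ₚ-congʳ p q≋q′))

*ₚ-zeroʳ : ∀ p → p *ₚ [] ≋ []
*ₚ-zeroʳ []      = ≋-refl
*ₚ-zeroʳ (a ∷ p) = coeffwise λ { zero → refl ; (suc j) → coeff-≡ (*ₚ-zeroʳ p) j }

*ₚ-identityˡ : ∀ p → 1ₚ *ₚ p ≋ p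
*ₚ-identityˡ p = coeffwise λ
  { zero    → trans (coeff-∷-*ₚ-zero 1 [] p) (*-identityˡ _)
  ; (suc j) → trans (coeff-∷-*ₚ-suc 1 [] p j) (trans (+-identityʳ _) (*-identityˡ _))
  }

*ₚ-distribˡ : ∀ p q r → p *ₚ (q +ₚ r) ≋ p *ₚ q +ₚ p *ₚ r
*ₚ-distribˡ []      q r = ≋-refl
*ₚ-distribˡ (a ∷ p) q r = begin
  a ·ₚ (q +ₚ r) +ₚ (0 ∷ p *ₚ (q +ₚ r))
    ≈⟨ +ₚ-cong (·ₚ-distribˡ a q r) (∷-cong refl (*ₚ-distribˡ p q r)) ⟩
  (a ·ₚ q +ₚ a ·ₚ r) +ₚ ((0 ∷ p *ₚ q) +ₚ (0 ∷ p *ₚ r))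
    ≈⟨ +ₚ-interchange (a ·ₚ q) (a ·ₚ r) _ _ ⟩
  (a ·ₚ q +ₚ (0 ∷ p *ₚ q)) +ₚ (a ·ₚ r +ₚ (0 ∷ p *ₚ r))
    ∎
  where open ≋-Reasoning

*ₚ-·ₚ : ∀ p c q → p *ₚ (c ·ₚ q) ≋ c ·ₚ (p *ₚ q)
*ₚ-·ₚ []      c q = ≋-refl
*ₚ-·ₚ (a ∷ p) c q = begin
  a ·ₚ (c ·ₚ q) +ₚ (0 ∷ p *ₚ (c ·ₚ q))  ≈⟨ +ₚ-cong (·ₚ-comm a c q) (∷-cong refl (*ₚ-·ₚ p c q)) ⟩
  c ·ₚ (a ·ₚ q) +ₚ (0 ∷ c ·ₚ (p *ₚ q))  ≈⟨ +ₚ-cong ≋-refl (·ₚ-shift c (p *ₚ q)) ⟨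
  c ·ₚ (a ·ₚ q) +ₚ c ·ₚ (0 ∷ p *ₚ q)    ≈⟨ ·ₚ-distribˡ c (a ·ₚ q) _ ⟨
  c ·ₚ (a ·ₚ q +ₚ (0 ∷ p *ₚ q))         ∎
  where open ≋-Reasoning

*ₚ-∷ : ∀ p a q → p *ₚ (a ∷ q) ≋ a ·ₚ p +ₚ (0 ∷ p *ₚ q)
*ₚ-∷ []      a q = coeffwise λ { zero → refl ; (suc j) → refl }
*ₚ-∷ (b ∷ p) a q = ∷-cong (cong (_+ 0) (*-comm b a)) (begin
  b ·ₚ q +ₚ p *ₚ (a ∷ q)                 ≈⟨ +ₚ-cong ≋-refl (*ₚ-∷ p a q) ⟩
  b ·ₚ q +ₚ (a ·ₚ p +ₚ (0 ∷ p *ₚ q))     ≈⟨ +ₚ-assoc (b ·ₚ q) (a ·ₚ p) _ ⟨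
  (b ·ₚ q +ₚ a ·ₚ p) +ₚ (0 ∷ p *ₚ q)     ≈⟨ +ₚ-cong (+ₚ-comm (b ·ₚ q) (a ·ₚ p)) ≋-refl ⟩
  (a ·ₚ p +ₚ b ·ₚ q) +ₚ (0 ∷ p *ₚ q)     ≈⟨ +ₚ-assoc (a ·ₚ p) (b ·ₚ q) _ ⟩
  a ·ₚ p +ₚ (b ·ₚ q +ₚ (0 ∷ p *ₚ q))     ∎)
  where open ≋-Reasoning

*ₚ-comm : ∀ p q → p *ₚ q ≋ q *ₚ p
*ₚ-comm []      q = ≋-sym (*ₚ-zeroʳ q)
*ₚ-comm (a ∷ p) q = ≋-trans (+ₚ-cong ≋-refl (∷-cong refl (*ₚ-comm p q))) (≋-sym (*ₚ-∷ q a p))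

*ₚ-shift : ∀ p q → p *ₚ (0 ∷ q) ≋ 0 ∷ p *ₚ q
*ₚ-shift p q = ≋-trans (*ₚ-∷ p 0 q) (+ₚ-cong (≡0⇒·ₚ≋[] p refl) ≋-refl)

1+X : Poly
1+X = 1ₚ +ₚ X

X-*ₚ : ∀ p → X *ₚ p ≋ 0 ∷ p
X-*ₚ p = +ₚ-cong (≡0⇒·ₚ≋[] p refl) (∷-cong refl (*ₚ-identityˡ p))

1+X-*ₚ : ∀ p → 1+X *ₚ p ≋ p +ₚ (0 ∷ p)
1+X-*ₚ p = +ₚ-cong (·ₚ-identityˡ p) (∷-cong refl (*ₚ-identityˡ p))

*ₚ-X : ∀ p q → p *ₚ (X *ₚ q) ≋ X *ₚ (p *ₚ q)
*ₚ-X p q = begin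
  p *ₚ (X *ₚ q)    ≈⟨ *ₚ-congʳ p (X-*ₚ q) ⟩
  p *ₚ (0 ∷ q)     ≈⟨ *ₚ-shift p q ⟩
  0 ∷ p *ₚ q       ≈⟨ X-*ₚ (p *ₚ q) ⟨
  X *ₚ (p *ₚ q)    ∎
  where open ≋-Reasoning

*ₚ-1+X : ∀ p q → p *ₚ (1+X *ₚ q) ≋ 1+X *ₚ (p *ₚ q)
*ₚ-1+X p q = begin
  p *ₚ (1+X *ₚ q)           ≈⟨ *ₚ-congʳ p (1+X-*ₚ q) ⟩
  p *ₚ (q +ₚ (0 ∷ q))       ≈⟨ *ₚ-distribˡ p q (0 ∷ q) ⟩
  p *ₚ q +ₚ p *ₚ (0 ∷ q)    ≈⟨ +ₚ-cong ≋-refl (*ₚ-shift p q) ⟩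
  p *ₚ q +ₚ (0 ∷ p *ₚ q)    ≈⟨ 1+X-*ₚ (p *ₚ q) ⟨
  1+X *ₚ (p *ₚ q)           ∎
  where open ≋-Reasoning

coeff-1+X-*ₚ-zero : ∀ p → coeff (1+X *ₚ p) 0 ≡ coeff p 0
coeff-1+X-*ₚ-zero p = trans (coeff-≡ (1+X-*ₚ p) 0) (trans (coeff-+ₚ p (0 ∷ p) 0) (+-identityʳ _))

coeff-1+X-*ₚ-suc : ∀ p j → coeff (1+X *ₚ p) (suc j) ≡ coeff p (suc j) + coeff p j
coeff-1+X-*ₚ-suc p j = trans (coeff-≡ (1+X-*ₚ p) (suc j)) (coeff-+ₚ p (0 ∷ p) (suc j))

sumₚ-cong : ∀ (l : List ℕ) {f g} → (∀ k → f k ≋ g k) → sumₚ l f ≋ sumₚ l g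
sumₚ-cong []      f≋g = ≋-refl
sumₚ-cong (x ∷ l) f≋g = +ₚ-cong (f≋g x) (sumₚ-cong l f≋g)

sumₚ-+ₚ : ∀ (l : List ℕ) f g → sumₚ l (λ k → f k +ₚ g k) ≋ sumₚ l f +ₚ sumₚ l g
sumₚ-+ₚ []      f g = ≋-refl
sumₚ-+ₚ (x ∷ l) f g = ≋-trans (+ₚ-cong ≋-refl (sumₚ-+ₚ l f g)) (+ₚ-interchange (f x) (g x) _ _)

sumₚ-·ₚ : ∀ (l : List ℕ) c f → sumₚ l (λ k → c ·ₚ f k) ≋ c ·ₚ sumₚ l f
sumₚ-·ₚ []      c f = ≋-refl
sumₚ-·ₚ (x ∷ l) c f = ≋-trans (+ₚ-cong ≋-refl (sumₚ-·ₚ l c f)) (≋-sym (·ₚ-distribˡ c (f x) _))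

sumₚ-*ₚ : ∀ (l : List ℕ) p f → sumₚ l (λ k → p *ₚ f k) ≋ p *ₚ sumₚ l f
sumₚ-*ₚ []      p f = ≋-sym (*ₚ-zeroʳ p)
sumₚ-*ₚ (x ∷ l) p f = ≋-trans (+ₚ-cong ≋-refl (sumₚ-*ₚ l p f)) (≋-sym (*ₚ-distribˡ p (f x) _))

sumₚ-vanish : ∀ (l : List ℕ) f → (∀ k → f k ≋ []) → sumₚ l f ≋ []
sumₚ-vanish []      f f≋[] = ≋-refl
sumₚ-vanish (x ∷ l) f f≋[] = +ₚ-cong (f≋[] x) (sumₚ-vanish l f f≋[])

sumₚ-map : ∀ g (l : List ℕ) f → sumₚ (map g l) f ≡ sumₚ l (f ∘ g)
sumₚ-map g []      f = refl
sumₚ-map g (x ∷ l) f = cong (f (g x) +ₚ_) (sumₚ-map g l f)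

sumₚ-upTo-suc : ∀ m f → sumₚ (upTo (suc m)) f ≡ f 0 +ₚ sumₚ (upTo m) (f ∘ suc)
sumₚ-upTo-suc m f =
  trans (cong (λ l → f 0 +ₚ sumₚ l f) (sym (map-upTo suc m))) (cong (f 0 +ₚ_) (sumₚ-map suc (upTo m) f))

sumₚ-upTo-suc-+ₚ : ∀ m f g →
  f 0 +ₚ sumₚ (upTo m) (λ k → f (suc k) +ₚ g k) ≋ sumₚ (upTo (suc m)) f +ₚ sumₚ (upTo m) g
sumₚ-upTo-suc-+ₚ m f g = begin
  f 0 +ₚ sumₚ (upTo m) (λ k → f (suc k) +ₚ g k)             ≈⟨ +ₚ-cong (≋-refl {f 0}) (sumₚ-+ₚ (upTo m) (f ∘ suc) g) ⟩
  f 0 +ₚ (sumₚ (upTo m) (f ∘ suc) +ₚ sumₚ (upTo m) g)       ≈⟨ +ₚ-assoc (f 0) _ _ ⟨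
  (f 0 +ₚ sumₚ (upTo m) (f ∘ suc)) +ₚ sumₚ (upTo m) g       ≡⟨ cong (_+ₚ sumₚ (upTo m) g) (sumₚ-upTo-suc m f) ⟨
  sumₚ (upTo (suc m)) f +ₚ sumₚ (upTo m) g                  ∎
  where open ≋-Reasoning

sumₚ-upTo-trim : ∀ {a m} f → a ≤ m → (∀ k → a ≤ k → f k ≋ []) → sumₚ (upTo m) f ≋ sumₚ (upTo a) f
sumₚ-upTo-trim {zero}  {m}     f a≤m       f≋[] = sumₚ-vanish (upTo m) f (λ k → f≋[] k z≤n)
sumₚ-upTo-trim {suc a} {suc m} f (s≤s a≤m) f≋[] rewrite sumₚ-upTo-suc m f | sumₚ-upTo-suc a f =
  +ₚ-cong ≋-refl (sumₚ-upTo-trim (f ∘ suc) a≤m (λ k a≤k → f≋[] (suc k) (s≤s a≤k)))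

sumₚ-range1 : ∀ n f → f 0 ≋ [] → sumₚ (range1 n) f ≋ sumₚ (upTo n) f
sumₚ-range1 zero    f f0≋[] = ≋-refl
sumₚ-range1 (suc m) f f0≋[] = begin
  sumₚ (map suc (upTo m)) f        ≡⟨ sumₚ-map suc (upTo m) f ⟩
  sumₚ (upTo m) (f ∘ suc)          ≈⟨ +ₚ-cong f0≋[] ≋-refl ⟨
  f 0 +ₚ sumₚ (upTo m) (f ∘ suc)   ≡⟨ sumₚ-upTo-suc m f ⟨
  sumₚ (upTo (suc m)) f            ∎
  where open ≋-Reasoning

sumₚ-monomials-suc : ∀ m (c : ℕ → ℕ) →
  sumₚ (upTo (suc m)) (λ k → c k ·ₚ X ^ₚ k) ≋ c 0 ∷ sumₚ (upTo m) (λ k → c (suc k) ·ₚ X ^ₚ k)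
sumₚ-monomials-suc m c = begin
  sumₚ (upTo (suc m)) (λ k → c k ·ₚ X ^ₚ k)
    ≡⟨ sumₚ-upTo-suc m (λ k → c k ·ₚ X ^ₚ k) ⟩
  c 0 ·ₚ 1ₚ +ₚ sumₚ (upTo m) (λ k → c (suc k) ·ₚ (X *ₚ X ^ₚ k))
    ≈⟨ +ₚ-cong ≋-refl (sumₚ-cong (upTo m) λ k → ≋-sym (*ₚ-·ₚ X (c (suc k)) (X ^ₚ k))) ⟩
  c 0 ·ₚ 1ₚ +ₚ sumₚ (upTo m) (λ k → X *ₚ (c (suc k) ·ₚ X ^ₚ k))
    ≈⟨ +ₚ-cong ≋-refl (sumₚ-*ₚ (upTo m) X (λ k → c (suc k) ·ₚ X ^ₚ k)) ⟩
  c 0 ·ₚ 1ₚ +ₚ X *ₚ sumₚ (upTo m) (λ k → c (suc k) ·ₚ X ^ₚ k)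
    ≈⟨ +ₚ-cong (≋-refl {c 0 ·ₚ 1ₚ}) (X-*ₚ _) ⟩
  c 0 ·ₚ 1ₚ +ₚ (0 ∷ sumₚ (upTo m) (λ k → c (suc k) ·ₚ X ^ₚ k))
    ≈⟨ ∷-cong (trans (+-identityʳ _) (*-identityʳ (c 0))) ≋-refl ⟩
  c 0 ∷ sumₚ (upTo m) (λ k → c (suc k) ·ₚ X ^ₚ k)
    ∎
  where open ≋-Reasoning

coeff-sumₚ-monomials : ∀ m (c : ℕ → ℕ) → (∀ k → m ≤ k → c k ≡ 0) →
  ∀ j → coeff (sumₚ (upTo m) (λ k → c k ·ₚ X ^ₚ k)) j ≡ c j
coeff-sumₚ-monomials zero    c c≡0 j       = sym (c≡0 j z≤n)
coeff-sumₚ-monomials (suc m) c c≡0 zero    = coeff-≡ (sumₚ-monomials-suc m c) 0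
coeff-sumₚ-monomials (suc m) c c≡0 (suc j) = trans (coeff-≡ (sumₚ-monomials-suc m c) (suc j))
  (coeff-sumₚ-monomials m (c ∘ suc) (λ k m≤k → c≡0 (suc k) (s≤s m≤k)) j)

C-absorption : ∀ n k → suc k * (suc n C suc k) ≡ suc n * (n C k)
C-absorption zero    zero    = refl
C-absorption zero    (suc k) = *-zeroʳ (suc (suc k))
C-absorption (suc n) zero    =
  trans (*-identityˡ _) (trans (nC1≡n (suc (suc n))) (sym (*-identityʳ (suc (suc n)))))
C-absorption (suc n) (suc k) = begin
  suc (suc k) * (suc (suc n) C suc (suc k))
    ≡⟨ cong (suc (suc k) *_) (nCk+nC[k+1]≡[n+1]C[k+1] (suc n) (suc k)) ⟨
  suc (suc k) * (a + b)
    ≡⟨ regroup k a b ⟩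
  a + (suc k * a + suc (suc k) * b)
    ≡⟨ cong (λ x → a + x) (cong₂ _+_ (C-absorption n k) (C-absorption n (suc k))) ⟩
  a + (suc n * (n C k) + suc n * (n C suc k))
    ≡⟨ cong (λ x → a + x) (*-distribˡ-+ (suc n) (n C k) (n C suc k)) ⟨
  a + suc n * (n C k + n C suc k)
    ≡⟨ cong (λ x → a + suc n * x) (nCk+nC[k+1]≡[n+1]C[k+1] n k) ⟩
  suc (suc n) * a
    ∎
  where
  open ≡-Reasoning
  a = suc n C suc k
  b = suc n C suc (suc k)
  regroup : ∀ k a b → suc (suc k) * (a + b) ≡ a + (suc k * a + suc (suc k) * b)
  regroup = solve-∀

C-absorption-complement : ∀ i e → suc e * (suc (i + e) C i) ≡ suc (i + e) * ((i + e) C i)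
C-absorption-complement i e = +-cancelʳ-≡ (i * (suc (i + e) C i)) _ _ (begin
  suc e * Y + i * Y            ≡⟨ split i e Y ⟩
  suc (i + e) * Y              ≡⟨ additive (i + e) i ⟩
  suc (i + e) * ((i + e) C i) + i * Y ∎)
  where
  open ≡-Reasoning
  Y = suc (i + e) C i
  split : ∀ i e y → suc e * y + i * y ≡ suc (i + e) * y
  split = solve-∀
  additive : ∀ n k → suc n * (suc n C k) ≡ suc n * (n C k) + k * (suc n C k)
  additive n zero    = sym (+-identityʳ _)
  additive n (suc k) = begin
    suc n * (suc n C suc k)                       ≡⟨ cong (suc n *_) (nCk+nC[k+1]≡[n+1]C[k+1] n k) ⟨
    suc n * (n C k + n C suc k)                   ≡⟨ *-distribˡ-+ (suc n) (n C k) (n C suc k) ⟩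
    suc n * (n C k) + suc n * (n C suc k)         ≡⟨ +-comm (suc n * (n C k)) _ ⟩
    suc n * (n C suc k) + suc n * (n C k)         ≡⟨ cong (suc n * (n C suc k) +_) (C-absorption n k) ⟨
    suc n * (n C suc k) + suc k * (suc n C suc k) ∎

C-ratio : ∀ i e → suc i * suc e * (suc (suc (i + e)) C suc i) ≡ suc (suc (i + e)) * suc (i + e) * ((i + e) C i)
C-ratio i e = begin
  suc i * suc e * (suc (suc (i + e)) C suc i)       ≡⟨ swap (suc i) (suc e) _ ⟩
  suc e * (suc i * (suc (suc (i + e)) C suc i))     ≡⟨ cong (suc e *_) (C-absorption (suc (i + e)) i) ⟩
  suc e * (suc (suc (i + e)) * (suc (i + e) C i))   ≡⟨ swap′ (suc e) (suc (suc (i + e))) (suc (i + e) C i) ⟩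
  suc (suc (i + e)) * (suc e * (suc (i + e) C i))   ≡⟨ cong (suc (suc (i + e)) *_) (C-absorption-complement i e) ⟩
  suc (suc (i + e)) * (suc (i + e) * ((i + e) C i)) ≡⟨ *-assoc (suc (suc (i + e))) (suc (i + e)) ((i + e) C i) ⟨
  suc (suc (i + e)) * suc (i + e) * ((i + e) C i)   ∎
  where
  open ≡-Reasoning
  swap : ∀ a b c → a * b * c ≡ b * (a * c)
  swap = solve-∀
  swap′ : ∀ a b c → a * (b * c) ≡ b * (a * c)
  swap′ = solve-∀

C-ratio-even : ∀ j d → suc (2 * j) * suc (2 * d) * ((2 * (j + d) + 2) C (2 * j + 1))
                     ≡ suc (suc (2 * (j + d))) * suc (2 * (j + d)) * ((2 * (j + d)) C (2 * j))
C-ratio-even j d = begin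
  suc (2 * j) * suc (2 * d) * ((2 * (j + d) + 2) C (2 * j + 1))
    ≡⟨ cong (λ b → suc (2 * j) * suc (2 * d) * b) (cong₂ _C_ (rearrange j d) (+-comm (2 * j) 1)) ⟩
  suc (2 * j) * suc (2 * d) * (suc (suc (2 * j + 2 * d)) C suc (2 * j))
    ≡⟨ C-ratio (2 * j) (2 * d) ⟩
  suc (suc (2 * j + 2 * d)) * suc (2 * j + 2 * d) * ((2 * j + 2 * d) C (2 * j))
    ≡⟨ cong (λ m → suc (suc m) * suc m * (m C (2 * j))) (*-distribˡ-+ 2 j d) ⟨
  suc (suc (2 * (j + d))) * suc (2 * (j + d)) * ((2 * (j + d)) C (2 * j))
    ∎
  where
  open ≡-Reasoning
  rearrange : ∀ j d → 2 * (j + d) + 2 ≡ suc (suc (2 * j + 2 * d))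
  rearrange = solve-∀

C-pascal² : ∀ m i → suc (suc m) C suc (suc i) ≡ m C suc (suc i) + m C i + 2 * (m C suc i)
C-pascal² m i = begin
  suc (suc m) C suc (suc i)
    ≡⟨ nCk+nC[k+1]≡[n+1]C[k+1] (suc m) (suc i) ⟨
  suc m C suc i + suc m C suc (suc i)
    ≡⟨ cong₂ _+_ (nCk+nC[k+1]≡[n+1]C[k+1] m i) (nCk+nC[k+1]≡[n+1]C[k+1] m (suc i)) ⟨
  (m C i + m C suc i) + (m C suc i + m C suc (suc i))
    ≡⟨ regroup (m C i) (m C suc i) _ ⟩
  m C suc (suc i) + m C i + 2 * (m C suc i)
    ∎
  where
  open ≡-Reasoning
  regroup : ∀ a b c → (a + b) + (b + c) ≡ c + a + 2 * b
  regroup = solve-∀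

monomial : ℕ → ℕ → Poly
monomial k m = X ^ₚ k *ₚ 1+X ^ₚ m

monomial-sucˡ : ∀ k m → monomial (suc k) m ≋ X *ₚ monomial k m
monomial-sucˡ k m = begin
  (X *ₚ X ^ₚ k) *ₚ 1+X ^ₚ m    ≈⟨ *ₚ-comm (X *ₚ X ^ₚ k) _ ⟩
  1+X ^ₚ m *ₚ (X *ₚ X ^ₚ k)    ≈⟨ *ₚ-X (1+X ^ₚ m) (X ^ₚ k) ⟩
  X *ₚ (1+X ^ₚ m *ₚ X ^ₚ k)    ≈⟨ *ₚ-congʳ X (*ₚ-comm (1+X ^ₚ m) (X ^ₚ k)) ⟩
  X *ₚ monomial k m            ∎
  where open ≋-Reasoning

·ₚ-monomial-sucʳ : ∀ c k m → c ·ₚ monomial k (suc m) ≋ 1+X *ₚ (c ·ₚ monomial k m)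
·ₚ-monomial-sucʳ c k m = begin
  c ·ₚ (X ^ₚ k *ₚ (1+X *ₚ 1+X ^ₚ m))   ≈⟨ ·ₚ-cong c (*ₚ-1+X (X ^ₚ k) (1+X ^ₚ m)) ⟩
  c ·ₚ (1+X *ₚ monomial k m)            ≈⟨ *ₚ-·ₚ 1+X c (monomial k m) ⟨
  1+X *ₚ (c ·ₚ monomial k m)            ∎
  where open ≋-Reasoning

-- In the binomial expansion of ((1 + x) + 2√x)^n, the term of index 2k is term n k (2k)
-- and the term of index 2k+1 is 2√x · term n k (2k+1).
term : ℕ → ℕ → ℕ → Poly
term n k i = (4 ^ k * (n C i)) ·ₚ monomial k (n ∸ i)

term-vanish : ∀ {n} k {i} → n < i → term n k i ≋ []
term-vanish k n<i = ≡0⇒·ₚ≋[] _ (trans (cong (4 ^ k *_) (k>n⇒nCk≡0 n<i)) (*-zeroʳ (4 ^ k)))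

term-sucˡ : ∀ n k i → term n (suc k) i ≋ 4 ·ₚ (X *ₚ term n k i)
term-sucˡ n k i = begin
  (4 * 4 ^ k * (n C i)) ·ₚ monomial (suc k) e   ≡⟨ cong (_·ₚ monomial (suc k) e) (*-assoc 4 (4 ^ k) (n C i)) ⟩
  (4 * c) ·ₚ monomial (suc k) e                 ≈⟨ ·ₚ-assoc 4 c _ ⟩
  4 ·ₚ (c ·ₚ monomial (suc k) e)                ≈⟨ ·ₚ-cong 4 (·ₚ-cong c (monomial-sucˡ k e)) ⟩
  4 ·ₚ (c ·ₚ (X *ₚ monomial k e))               ≈⟨ ·ₚ-cong 4 (*ₚ-·ₚ X c (monomial k e)) ⟨
  4 ·ₚ (X *ₚ term n k i)                        ∎
  where
  open ≋-Reasoning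
  c = 4 ^ k * (n C i)
  e = n ∸ i

-- The exponent n ∸ i is truncated: it equals 1 + (n ∸ (i+1)) only when i < n,
-- and otherwise C(n, i+1) = 0 makes both sides vanish.
term-raise : ∀ n k i → (4 ^ k * (n C suc i)) ·ₚ monomial k (n ∸ i) ≋ 1+X *ₚ term n k (suc i)
term-raise n k i with suc i ≤? n
term-raise (suc n) k i | yes (s≤s i≤n) = begin
  c ·ₚ monomial k (suc n ∸ i)      ≡⟨ cong (λ e → c ·ₚ monomial k e) (+-∸-assoc 1 i≤n) ⟩
  c ·ₚ monomial k (suc (n ∸ i))    ≈⟨ ·ₚ-monomial-sucʳ c k (n ∸ i) ⟩
  1+X *ₚ term (suc n) k (suc i)    ∎
  where
  open ≋-Reasoning
  c = 4 ^ k * (suc n C suc i)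
... | no i≮n = begin
  (4 ^ k * (n C suc i)) ·ₚ monomial k (n ∸ i)   ≈⟨ ≡0⇒·ₚ≋[] _ vanish ⟩
  []                                            ≈⟨ *ₚ-zeroʳ 1+X ⟨
  1+X *ₚ []                                     ≈⟨ *ₚ-congʳ 1+X (≡0⇒·ₚ≋[] _ vanish) ⟨
  1+X *ₚ term n k (suc i)                       ∎
  where
  open ≋-Reasoning
  vanish : 4 ^ k * (n C suc i) ≡ 0
  vanish = trans (cong (4 ^ k *_) (k>n⇒nCk≡0 (≰⇒> i≮n))) (*-zeroʳ (4 ^ k))

term-suc : ∀ n k i → term (suc n) k (suc i) ≋ term n k i +ₚ 1+X *ₚ term n k (suc i)
term-suc n k i = begin
  (4 ^ k * (suc n C suc i)) ·ₚ M                    ≡⟨ cong (λ c → (4 ^ k * c) ·ₚ M) (nCk+nC[k+1]≡[n+1]C[k+1] n i) ⟨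
  (4 ^ k * (n C i + n C suc i)) ·ₚ M                ≡⟨ cong (_·ₚ M) (*-distribˡ-+ (4 ^ k) (n C i) (n C suc i)) ⟩
  (4 ^ k * (n C i) + 4 ^ k * (n C suc i)) ·ₚ M      ≈⟨ ·ₚ-distribʳ (4 ^ k * (n C i)) _ M ⟩
  term n k i +ₚ (4 ^ k * (n C suc i)) ·ₚ M          ≈⟨ +ₚ-cong (≋-refl {term n k i}) (term-raise n k i) ⟩
  term n k i +ₚ 1+X *ₚ term n k (suc i)             ∎
  where
  open ≋-Reasoning
  M = monomial k (n ∸ i)

evenPart oddPart : ℕ → Poly
evenPart n = sumₚ (upTo (suc n)) (λ k → term n k (2 * k))
oddPart  n = sumₚ (upTo (suc n)) (λ k → term n k (suc (2 * k)))

evenPart-extend : ∀ n → sumₚ (upTo (2 + n)) (λ k → term n k (2 * k)) ≋ evenPart n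
evenPart-extend n = sumₚ-upTo-trim _ (n≤1+n (suc n)) λ k n<k →
  term-vanish k (<-≤-trans n<k (m≤m+n k (k + 0)))

oddPart-extend : ∀ n → sumₚ (upTo (2 + n)) (λ k → term n k (suc (2 * k))) ≋ oddPart n
oddPart-extend n = sumₚ-upTo-trim _ (n≤1+n (suc n)) λ k n<k →
  term-vanish k (m<n⇒m<1+n (<-≤-trans n<k (m≤m+n k (k + 0))))

term-even-suc : ∀ n k →
  term (suc n) (suc k) (2 * suc k) ≋ 1+X *ₚ term n (suc k) (2 * suc k) +ₚ 4 ·ₚ (X *ₚ term n k (suc (2 * k)))
term-even-suc n k = begin
  term (suc n) (suc k) (2 * suc k)
    ≡⟨ cong (term (suc n) (suc k)) (*-suc 2 k) ⟩
  term (suc n) (suc k) (2 + 2 * k)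
    ≈⟨ term-suc n (suc k) (suc (2 * k)) ⟩
  term n (suc k) (suc (2 * k)) +ₚ 1+X *ₚ term n (suc k) (2 + 2 * k)
    ≈⟨ +ₚ-comm (term n (suc k) (suc (2 * k))) _ ⟩
  1+X *ₚ term n (suc k) (2 + 2 * k) +ₚ term n (suc k) (suc (2 * k))
    ≈⟨ +ₚ-cong (*ₚ-congʳ 1+X (≡⇒≋ (cong (term n (suc k)) (sym (*-suc 2 k))))) (term-sucˡ n k (suc (2 * k))) ⟩
  1+X *ₚ term n (suc k) (2 * suc k) +ₚ 4 ·ₚ (X *ₚ term n k (suc (2 * k)))
    ∎
  where open ≋-Reasoning

evenPart-suc : ∀ n → evenPart (suc n) ≋ 1+X *ₚ evenPart n +ₚ 4 ·ₚ (X *ₚ oddPart n)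
evenPart-suc n = begin
  sumₚ (upTo (2 + n)) (λ k → term (suc n) k (2 * k))
    ≡⟨ sumₚ-upTo-suc (suc n) (λ k → term (suc n) k (2 * k)) ⟩
  term (suc n) 0 0 +ₚ sumₚ (upTo (suc n)) (λ k → term (suc n) (suc k) (2 * suc k))
    ≈⟨ +ₚ-cong (·ₚ-monomial-sucʳ 1 0 n) (sumₚ-cong (upTo (suc n)) (term-even-suc n)) ⟩
  1+X *ₚ e 0 +ₚ sumₚ (upTo (suc n)) (λ k → 1+X *ₚ e (suc k) +ₚ 4 ·ₚ (X *ₚ o k))
    ≈⟨ sumₚ-upTo-suc-+ₚ (suc n) (λ k → 1+X *ₚ e k) (λ k → 4 ·ₚ (X *ₚ o k)) ⟩
  sumₚ (upTo (2 + n)) (λ k → 1+X *ₚ e k) +ₚ sumₚ (upTo (suc n)) (λ k → 4 ·ₚ (X *ₚ o k))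
    ≈⟨ +ₚ-cong (sumₚ-*ₚ (upTo (2 + n)) 1+X e)
               (≋-trans (sumₚ-·ₚ (upTo (suc n)) 4 (λ k → X *ₚ o k)) (·ₚ-cong 4 (sumₚ-*ₚ (upTo (suc n)) X o))) ⟩
  1+X *ₚ sumₚ (upTo (2 + n)) e +ₚ 4 ·ₚ (X *ₚ oddPart n)
    ≈⟨ +ₚ-cong (*ₚ-congʳ 1+X (evenPart-extend n)) ≋-refl ⟩
  1+X *ₚ evenPart n +ₚ 4 ·ₚ (X *ₚ oddPart n)
    ∎
  where
  open ≋-Reasoning
  e o : ℕ → Poly
  e k = term n k (2 * k)
  o k = term n k (suc (2 * k))

oddPart-suc : ∀ n → oddPart (suc n) ≋ evenPart n +ₚ 1+X *ₚ oddPart n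
oddPart-suc n = begin
  sumₚ (upTo (2 + n)) (λ k → term (suc n) k (suc (2 * k)))
    ≈⟨ sumₚ-cong (upTo (2 + n)) (λ k → term-suc n k (2 * k)) ⟩
  sumₚ (upTo (2 + n)) (λ k → e k +ₚ 1+X *ₚ o k)
    ≈⟨ sumₚ-+ₚ (upTo (2 + n)) e (λ k → 1+X *ₚ o k) ⟩
  sumₚ (upTo (2 + n)) e +ₚ sumₚ (upTo (2 + n)) (λ k → 1+X *ₚ o k)
    ≈⟨ +ₚ-cong (evenPart-extend n) (≋-trans (sumₚ-*ₚ (upTo (2 + n)) 1+X o) (*ₚ-congʳ 1+X (oddPart-extend n))) ⟩
  evenPart n +ₚ 1+X *ₚ oddPart n
    ∎
  where
  open ≋-Reasoning
  e o : ℕ → Poly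
  e k = term n k (2 * k)
  o k = term n k (suc (2 * k))

coeff-evenPart-rec : ∀ n j →
  coeff (evenPart (suc n)) j ≡ coeff (1+X *ₚ evenPart n) j + 4 * coeff (0 ∷ oddPart n) j
coeff-evenPart-rec n j = begin
  coeff (evenPart (suc n)) j
    ≡⟨ coeff-≡ (evenPart-suc n) j ⟩
  coeff (1+X *ₚ E +ₚ 4 ·ₚ (X *ₚ O)) j
    ≡⟨ coeff-+ₚ (1+X *ₚ E) (4 ·ₚ (X *ₚ O)) j ⟩
  coeff (1+X *ₚ E) j + coeff (4 ·ₚ (X *ₚ O)) j
    ≡⟨ cong (coeff (1+X *ₚ E) j +_) (coeff-·ₚ 4 (X *ₚ O) j) ⟩
  coeff (1+X *ₚ E) j + 4 * coeff (X *ₚ O) j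
    ≡⟨ cong (λ x → coeff (1+X *ₚ E) j + 4 * x) (coeff-≡ (X-*ₚ O) j) ⟩
  coeff (1+X *ₚ E) j + 4 * coeff (0 ∷ O) j
    ∎
  where
  open ≡-Reasoning
  E = evenPart n
  O = oddPart n

coeff-oddPart-rec : ∀ n j → coeff (oddPart (suc n)) j ≡ coeff (evenPart n) j + coeff (1+X *ₚ oddPart n) j
coeff-oddPart-rec n j = trans (coeff-≡ (oddPart-suc n) j) (coeff-+ₚ (evenPart n) _ j)

coeff-evenPart : ∀ n j → coeff (evenPart n) j ≡ (2 * n) C (2 * j)
coeff-oddPart  : ∀ n j → 2 * coeff (oddPart n) j ≡ (2 * n) C suc (2 * j)

coeff-evenPart zero    zero    = refl
coeff-evenPart zero    (suc j) = refl
coeff-evenPart (suc n) zero    = begin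
  coeff (evenPart (suc n)) 0              ≡⟨ coeff-evenPart-rec n 0 ⟩
  coeff (1+X *ₚ evenPart n) 0 + 0         ≡⟨ +-identityʳ _ ⟩
  coeff (1+X *ₚ evenPart n) 0             ≡⟨ coeff-1+X-*ₚ-zero (evenPart n) ⟩
  coeff (evenPart n) 0                    ≡⟨ coeff-evenPart n 0 ⟩
  1                                       ∎
  where open ≡-Reasoning
coeff-evenPart (suc n) (suc j) = begin
  coeff (evenPart (suc n)) (suc j)
    ≡⟨ coeff-evenPart-rec n (suc j) ⟩
  coeff (1+X *ₚ E) (suc j) + 4 * coeff O j
    ≡⟨ cong₂ _+_ (coeff-1+X-*ₚ-suc E j) (*-assoc 2 2 (coeff O j)) ⟩
  coeff E (suc j) + coeff E j + 2 * (2 * coeff O j)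
    ≡⟨ cong₂ _+_ (cong₂ _+_ (coeff-evenPart n (suc j)) (coeff-evenPart n j)) (cong (2 *_) (coeff-oddPart n j)) ⟩
  (2 * n) C (2 * suc j) + (2 * n) C (2 * j) + 2 * ((2 * n) C suc (2 * j))
    ≡⟨ cong (λ i → (2 * n) C i + (2 * n) C (2 * j) + 2 * ((2 * n) C suc (2 * j))) (*-suc 2 j) ⟩
  (2 * n) C (2 + 2 * j) + (2 * n) C (2 * j) + 2 * ((2 * n) C suc (2 * j))
    ≡⟨ C-pascal² (2 * n) (2 * j) ⟨
  (2 + 2 * n) C (2 + 2 * j)
    ≡⟨ cong₂ _C_ (*-suc 2 n) (*-suc 2 j) ⟨
  (2 * suc n) C (2 * suc j)
    ∎
  where
  open ≡-Reasoning
  E = evenPart n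
  O = oddPart n

coeff-oddPart zero    zero    = refl
coeff-oddPart zero    (suc j) = refl
coeff-oddPart (suc n) zero    = begin
  2 * coeff (oddPart (suc n)) 0
    ≡⟨ cong (2 *_) (coeff-oddPart-rec n 0) ⟩
  2 * (coeff E 0 + coeff (1+X *ₚ O) 0)
    ≡⟨ cong (λ x → 2 * (coeff E 0 + x)) (coeff-1+X-*ₚ-zero O) ⟩
  2 * (coeff E 0 + coeff O 0)
    ≡⟨ *-distribˡ-+ 2 (coeff E 0) (coeff O 0) ⟩
  2 * coeff E 0 + 2 * coeff O 0
    ≡⟨ cong₂ _+_ (cong (2 *_) (coeff-evenPart n 0)) (coeff-oddPart n 0) ⟩
  2 + (2 * n) C 1
    ≡⟨ cong (2 +_) (nC1≡n (2 * n)) ⟩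
  2 + 2 * n
    ≡⟨ trans (nC1≡n (2 * suc n)) (*-suc 2 n) ⟨
  (2 * suc n) C 1
    ∎
  where
  open ≡-Reasoning
  E = evenPart n
  O = oddPart n
coeff-oddPart (suc n) (suc j) = begin
  2 * coeff (oddPart (suc n)) (suc j)
    ≡⟨ cong (2 *_) (coeff-oddPart-rec n (suc j)) ⟩
  2 * (coeff E (suc j) + coeff (1+X *ₚ O) (suc j))
    ≡⟨ cong (λ x → 2 * (coeff E (suc j) + x)) (coeff-1+X-*ₚ-suc O j) ⟩
  2 * (coeff E (suc j) + (coeff O (suc j) + coeff O j))
    ≡⟨ regroup (coeff E (suc j)) (coeff O (suc j)) (coeff O j) ⟩
  2 * coeff O (suc j) + 2 * coeff O j + 2 * coeff E (suc j)
    ≡⟨ cong₂ _+_ (cong₂ _+_ (coeff-oddPart n (suc j)) (coeff-oddPart n j)) (cong (2 *_) (coeff-evenPart n (suc j))) ⟩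
  (2 * n) C suc (2 * suc j) + (2 * n) C suc (2 * j) + 2 * ((2 * n) C (2 * suc j))
    ≡⟨ cong (λ i → (2 * n) C suc i + (2 * n) C suc (2 * j) + 2 * ((2 * n) C i)) (*-suc 2 j) ⟩
  (2 * n) C (3 + 2 * j) + (2 * n) C suc (2 * j) + 2 * ((2 * n) C (2 + 2 * j))
    ≡⟨ C-pascal² (2 * n) (suc (2 * j)) ⟨
  (2 + 2 * n) C (3 + 2 * j)
    ≡⟨ cong₂ (λ m i → m C suc i) (*-suc 2 n) (*-suc 2 j) ⟨
  (2 * suc n) C suc (2 * suc j)
    ∎
  where
  open ≡-Reasoning
  E = evenPart n
  O = oddPart n
  regroup : ∀ e o₁ o₀ → 2 * (e + (o₁ + o₀)) ≡ 2 * o₁ + 2 * o₀ + 2 * e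
  regroup = solve-∀

γ : ℕ → ℕ → ℕ
γ n zero    = 0
γ n (suc k) = 2 * suc k * 4 ^ k * (suc n C suc (2 * suc k))

N : ℕ → Poly
N n = sumₚ (upTo (n / 2 + 1)) (λ k → γ n k ·ₚ monomial k (n ∸ 2 * k))

γ-scaled : ∀ n k → 4 * γ n k + 4 ^ k * (suc n C suc (2 * k)) ≡ suc n * (4 ^ k * (n C (2 * k)))
γ-scaled n zero    = C-absorption n 0
γ-scaled n (suc k) = begin
  4 * (2 * suc k * 4 ^ k * B) + 4 * 4 ^ k * B     ≡⟨ collect k (4 ^ k) B ⟩
  4 * 4 ^ k * (suc (2 * suc k) * B)               ≡⟨ cong (4 * 4 ^ k *_) (C-absorption n (2 * suc k)) ⟩
  4 * 4 ^ k * (suc n * (n C (2 * suc k)))         ≡⟨ swap (4 * 4 ^ k) (suc n) _ ⟩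
  suc n * (4 * 4 ^ k * (n C (2 * suc k)))         ∎
  where
  open ≡-Reasoning
  B = suc n C suc (2 * suc k)
  collect : ∀ k q b → 4 * (2 * suc k * q * b) + 4 * q * b ≡ 4 * q * (suc (2 * suc k) * b)
  collect = solve-∀
  swap : ∀ a b c → a * (b * c) ≡ b * (a * c)
  swap = solve-∀

n<2*[n/2+1] : ∀ n → n < 2 * (n / 2 + 1)
n<2*[n/2+1] n = begin-strict
  n                    ≡⟨ m≡m%n+[m/n]*n n 2 ⟩
  n % 2 + n / 2 * 2    <⟨ +-monoˡ-< (n / 2 * 2) (m%n<n n 2) ⟩
  2 + n / 2 * 2        ≡⟨ rearrange (n / 2) ⟩
  2 * (n / 2 + 1)      ∎
  where
  open ≤-Reasoning
  rearrange : ∀ h → 2 + h * 2 ≡ 2 * (h + 1)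
  rearrange = solve-∀

γ-vanish : ∀ n k → n / 2 + 1 ≤ k → γ n k ≡ 0
γ-vanish n zero    _      = refl
γ-vanish n (suc k) n/2<k = trans (cong (2 * suc k * 4 ^ k *_) (k>n⇒nCk≡0 (s≤s n<2k))) (*-zeroʳ (2 * suc k * 4 ^ k))
  where
  n<2k : n < 2 * suc k
  n<2k = <-≤-trans (n<2*[n/2+1] n) (*-monoʳ-≤ 2 n/2<k)

N-extend : ∀ n → N n ≋ sumₚ (upTo (2 + n)) (λ k → γ n k ·ₚ monomial k (n ∸ 2 * k))
N-extend n = ≋-sym (sumₚ-upTo-trim _ n/2+1≤2+n λ k n/2<k → ≡0⇒·ₚ≋[] _ (γ-vanish n k n/2<k))
  where
  n/2+1≤2+n : n / 2 + 1 ≤ suc (suc n)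
  n/2+1≤2+n = ≤-trans (≤-reflexive (+-comm (n / 2) 1)) (s≤s (≤-trans (m/n≤m n 2) (n≤1+n n)))

N-relation : ∀ n → 4 ·ₚ N n +ₚ oddPart (suc n) ≋ suc n ·ₚ evenPart n
N-relation n = begin
  4 ·ₚ N n +ₚ oddPart (suc n)                    ≈⟨ +ₚ-cong (·ₚ-cong 4 (N-extend n)) (≋-refl {oddPart (suc n)}) ⟩
  4 ·ₚ sumₚ ks g +ₚ sumₚ ks o                    ≈⟨ +ₚ-cong (sumₚ-·ₚ ks 4 g) (≋-refl {sumₚ ks o}) ⟨
  sumₚ ks (λ k → 4 ·ₚ g k) +ₚ sumₚ ks o          ≈⟨ sumₚ-+ₚ ks (λ k → 4 ·ₚ g k) o ⟨
  sumₚ ks (λ k → 4 ·ₚ g k +ₚ o k)                ≈⟨ sumₚ-cong ks termwise ⟩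
  sumₚ ks (λ k → suc n ·ₚ e k)                   ≈⟨ sumₚ-·ₚ ks (suc n) e ⟩
  suc n ·ₚ sumₚ ks e                             ≈⟨ ·ₚ-cong (suc n) (evenPart-extend n) ⟩
  suc n ·ₚ evenPart n                            ∎
  where
  open ≋-Reasoning
  ks = upTo (2 + n)
  g o e : ℕ → Poly
  g k = γ n k ·ₚ monomial k (n ∸ 2 * k)
  o k = term (suc n) k (suc (2 * k))
  e k = term n k (2 * k)
  termwise : ∀ k → 4 ·ₚ g k +ₚ o k ≋ suc n ·ₚ e k
  termwise k = begin
    4 ·ₚ (γ n k ·ₚ M) +ₚ (4 ^ k * (suc n C suc (2 * k))) ·ₚ M
      ≈⟨ +ₚ-cong (·ₚ-assoc 4 (γ n k) M) ≋-refl ⟨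
    (4 * γ n k) ·ₚ M +ₚ (4 ^ k * (suc n C suc (2 * k))) ·ₚ M
      ≈⟨ ·ₚ-distribʳ (4 * γ n k) _ M ⟨
    (4 * γ n k + 4 ^ k * (suc n C suc (2 * k))) ·ₚ M
      ≡⟨ cong (_·ₚ M) (γ-scaled n k) ⟩
    (suc n * (4 ^ k * (n C (2 * k)))) ·ₚ M
      ≈⟨ ·ₚ-assoc (suc n) (4 ^ k * (n C (2 * k))) M ⟩
    suc n ·ₚ e k
      ∎
    where M = monomial k (n ∸ 2 * k)

coeff-N-relation : ∀ n j → 4 * coeff (N n) j + coeff (oddPart (suc n)) j ≡ suc n * ((2 * n) C (2 * j))
coeff-N-relation n j = begin
  4 * coeff (N n) j + coeff (oddPart (suc n)) j   ≡⟨ cong (_+ coeff (oddPart (suc n)) j) (coeff-·ₚ 4 (N n) j) ⟨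
  coeff (4 ·ₚ N n) j + coeff (oddPart (suc n)) j  ≡⟨ coeff-+ₚ (4 ·ₚ N n) (oddPart (suc n)) j ⟨
  coeff (4 ·ₚ N n +ₚ oddPart (suc n)) j           ≡⟨ coeff-≡ (N-relation n) j ⟩
  coeff (suc n ·ₚ evenPart n) j                   ≡⟨ coeff-·ₚ (suc n) (evenPart n) j ⟩
  suc n * coeff (evenPart n) j                    ≡⟨ cong (suc n *_) (coeff-evenPart n j) ⟩
  suc n * ((2 * n) C (2 * j))                     ∎
  where open ≡-Reasoning

-- Eliminating o: (2n+1)(8t + C′) = (2n+1)(2n+2) B = (2j+1)(2d+1) C′ = (4jd + 2n+1) C′, with n = j + d.
eliminate-odd : ∀ j d t o B C′ →
  4 * t + o ≡ suc (j + d) * B →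
  2 * o ≡ C′ →
  suc (2 * j) * suc (2 * d) * C′ ≡ suc (suc (2 * (j + d))) * suc (2 * (j + d)) * B →
  (4 * (j + d) + 2) * t ≡ j * d * C′
eliminate-odd j d t o B C′ h₁ h₂ ratio = *-cancelˡ-≡ _ _ 4 (begin
  4 * ((4 * (j + d) + 2) * t)   ≡⟨ scale j d t ⟩
  s * (8 * t)                   ≡⟨ +-cancelʳ-≡ (s * C′) _ _ eq ⟩
  4 * j * d * C′                ≡⟨ reassociate j d C′ ⟩
  4 * (j * d * C′)              ∎)
  where
  open ≡-Reasoning
  s = suc (2 * (j + d))
  scale : ∀ j d t → 4 * ((4 * (j + d) + 2) * t) ≡ suc (2 * (j + d)) * (8 * t)
  scale = solve-∀
  reassociate : ∀ j d c → 4 * j * d * c ≡ 4 * (j * d * c)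
  reassociate = solve-∀
  factor : ∀ s t o → s * (8 * t) + s * (2 * o) ≡ 2 * s * (4 * t + o)
  factor = solve-∀
  regroup : ∀ m b → 2 * suc (2 * m) * (suc m * b) ≡ suc (suc (2 * m)) * suc (2 * m) * b
  regroup = solve-∀
  expand : ∀ j d c → suc (2 * j) * suc (2 * d) * c ≡ 4 * j * d * c + suc (2 * (j + d)) * c
  expand = solve-∀
  eq : s * (8 * t) + s * C′ ≡ 4 * j * d * C′ + s * C′
  eq = begin
    s * (8 * t) + s * C′                   ≡⟨ cong (λ x → s * (8 * t) + s * x) h₂ ⟨
    s * (8 * t) + s * (2 * o)              ≡⟨ factor s t o ⟩
    2 * s * (4 * t + o)                    ≡⟨ cong (2 * s *_) h₁ ⟩
    2 * s * (suc (j + d) * B)              ≡⟨ regroup (j + d) B ⟩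
    suc s * s * B                          ≡⟨ ratio ⟨
    suc (2 * j) * suc (2 * d) * C′         ≡⟨ expand j d C′ ⟩
    4 * j * d * C′ + s * C′                ∎

coefficient-equation : ∀ n j t o →
  4 * t + o ≡ suc n * ((2 * n) C (2 * j)) →
  2 * o ≡ (2 * n + 2) C (2 * j + 1) →
  (4 * n + 2) * t ≡ j * (n ∸ j) * ((2 * n + 2) C (2 * j + 1))
coefficient-equation n j t o h₁ h₂ with j ≤? n
... | no j≰n = begin
  (4 * n + 2) * t      ≡⟨ cong ((4 * n + 2) *_) t≡0 ⟩
  (4 * n + 2) * 0      ≡⟨ *-zeroʳ (4 * n + 2) ⟩
  0                    ≡⟨ cong (_* C′) (*-zeroʳ j) ⟨
  j * 0 * C′           ≡⟨ cong (λ x → j * x * C′) (m≤n⇒m∸n≡0 (<⇒≤ n<j)) ⟨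
  j * (n ∸ j) * C′     ∎
  where
  open ≡-Reasoning
  C′ = (2 * n + 2) C (2 * j + 1)
  n<j = ≰⇒> j≰n
  4t+o≡0 : 4 * t + o ≡ 0
  4t+o≡0 = trans h₁ (trans (cong (suc n *_) (k>n⇒nCk≡0 (*-monoʳ-< 2 n<j))) (*-zeroʳ (suc n)))
  t≡0 : t ≡ 0
  t≡0 = m+n≡0⇒m≡0 t (m+n≡0⇒m≡0 (4 * t) 4t+o≡0)
... | yes j≤n with n ∸ j | m+[n∸m]≡n j≤n
...   | d | refl = eliminate-odd j d t o _ _ h₁ h₂ (C-ratio-even j d)

coeff-oddPart-suc : ∀ n j → 2 * coeff (oddPart (suc n)) j ≡ (2 * n + 2) C (2 * j + 1)
coeff-oddPart-suc n j = trans (coeff-oddPart (suc n) j) (cong₂ _C_ (double-suc n) (+-comm 1 (2 * j)))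
  where
  double-suc : ∀ n → 2 * suc n ≡ 2 * n + 2
  double-suc = solve-∀

mainTheorem3 : (n : ℕ) → ∃ λ (γ : ℕ → ℕ) →
    ((4 * n + 2) ·ₚ sumₚ (upTo (n / 2 + 1)) (λ k → γ k ·ₚ ((X ^ₚ k) *ₚ ((1ₚ +ₚ X) ^ₚ (n ∸ 2 * k)))))
      ≈ₚ sumₚ (range1 n) (λ k → (k * (n ∸ k) * ((2 * n + 2) C (2 * k + 1))) ·ₚ (X ^ₚ k))
mainTheorem3 n = γ n , λ j → begin
  coeff ((4 * n + 2) ·ₚ N n) j
    ≡⟨ coeff-·ₚ (4 * n + 2) (N n) j ⟩
  (4 * n + 2) * coeff (N n) j
    ≡⟨ coefficient-equation n j _ _ (coeff-N-relation n j) (coeff-oddPart-suc n j) ⟩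
  c j
    ≡⟨ coeff-sumₚ-monomials n c c-vanish j ⟨
  coeff (sumₚ (upTo n) (λ k → c k ·ₚ X ^ₚ k)) j
    ≡⟨ coeff-≡ (sumₚ-range1 n (λ k → c k ·ₚ X ^ₚ k) (≡0⇒·ₚ≋[] 1ₚ refl)) j ⟨
  coeff (sumₚ (range1 n) (λ k → c k ·ₚ X ^ₚ k)) j
    ∎
  where
  open ≡-Reasoning
  c : ℕ → ℕ
  c k = k * (n ∸ k) * ((2 * n + 2) C (2 * k + 1))
  c-vanish : ∀ k → n ≤ k → c k ≡ 0
  c-vanish k n≤k = begin
    k * (n ∸ k) * ((2 * n + 2) C (2 * k + 1))   ≡⟨ cong (λ x → k * x * ((2 * n + 2) C (2 * k + 1))) (m≤n⇒m∸n≡0 n≤k) ⟩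
    k * 0 * ((2 * n + 2) C (2 * k + 1))         ≡⟨ cong (_* ((2 * n + 2) C (2 * k + 1))) (*-zeroʳ k) ⟩
    0                                           ∎
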